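{- Let $\alpha=n_1\omega^{\alpha_1}+\cdots+n_k\omega^{\alpha_k}$ be an ordinal in Cantor normal form ($\alpha_1>\cdots>\alpha_k$ ordinals, $n_i$ natural numbers, $n_1\ne0$). Then $\alpha/\!\sim_F\;\cong\sum_{i=1}^k\big(n_i\omega^{\alpha_i}\big)/\!\sim_F$.
   Context: Products are lexicographic, so $n\omega^{\gamma}$ denotes $n$ copies of $\omega^{\gamma}$ laid end to end. For a linear order $L$, $x\sim_F y$ iff only finitely many points lie between $x$ and $y$; $L/\!\sim_F$ is the ordered set of classes; $\sum$ is the ordered sum. -}

module Defs where

open import Level using (0ℓ)
open import Data.Nat using (ℕ)
open import Data.Fin using (Fin) renaming (_<_ to _<ᶠ_)
open import Data.Product using (Σ; _×_; _,_; proj₁)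
open import Data.Sum using (_⊎_)
open import Data.List using (List)
open import Data.List.Relation.Unary.Any using (Any)
open import Data.List.Relation.Unary.Linked using (Linked)
open import Data.List.Relation.Binary.Pointwise using (Pointwise)
open import Data.List.Relation.Binary.Lex.Strict using (Lex-<)
open import Relation.Binary using (Rel; IsStrictTotalOrder)
open import Relation.Binary.PropositionalEquality using (_≡_)
open import Induction.WellFounded using (WellFounded)
open import Relation.Nullary using (¬_)

-- The constructions below (sums, ω^γ, condensation)
-- are linear orders; we only need their data to speak of isomorphism.

record Str : Set₁ where
  field
    Carrier : Set
    _≈_     : Rel Carrier 0ℓ
    _<_     : Rel Carrier 0ℓ

open Str public

record _≅_ (A B : Str) : Set where
  field
    to        : Carrier A → Carrier B
    from      : Carrier B → Carrier A
    to-cong   : ∀ {x y} → _≈_ A x y → _≈_ B (to x) (to y)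
    from-cong : ∀ {x y} → _≈_ B x y → _≈_ A (from x) (from y)
    to-from   : ∀ y → _≈_ B (to (from y)) y
    from-to   : ∀ x → _≈_ A (from (to x)) x
    to-mono   : ∀ {x y} → _<_ A x y → _<_ B (to x) (to y)
    to-refl   : ∀ {x y} → _<_ B (to x) (to y) → _<_ A x y

record Ordinal : Set₁ where
  field
    str   : Str
    isSTO : IsStrictTotalOrder (_≈_ str) (_<_ str)
    wf    : WellFounded (_<_ str)

open Ordinal public

Seg : (L : Str) → Carrier L → Str
Seg L a = record
  { Carrier = Σ (Carrier L) (λ x → _<_ L x a)
  ; _≈_     = λ p q → _≈_ L (proj₁ p) (proj₁ q)
  ; _<_     = λ p q → _<_ L (proj₁ p) (proj₁ q)
  }

_<ₒ_ : Ordinal → Ordinal → Set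
β <ₒ α = Σ (Carrier (str α)) (λ a → str β ≅ Seg (str α) a)

module _ {k : ℕ} (F : Fin k → Str) where
  data SumEq : Rel (Σ (Fin k) (λ i → Carrier (F i))) 0ℓ where
    same : ∀ {i x y} → _≈_ (F i) x y → SumEq (i , x) (i , y)

  data SumLt : Rel (Σ (Fin k) (λ i → Carrier (F i))) 0ℓ where
    idx   : ∀ {i j x y} → i <ᶠ j → SumLt (i , x) (j , y)
    inner : ∀ {i x y} → _<_ (F i) x y → SumLt (i , x) (i , y)

OSum : (k : ℕ) → (Fin k → Str) → Str
OSum k F = record
  { Carrier = Σ (Fin k) (λ i → Carrier (F i))
  ; _≈_     = SumEq F
  ; _<_     = SumLt F
  }

Times : ℕ → Str → Str
Times n L = OSum n (λ _ → L)

-- ω^γ for an ordinal γ: finite non-increasing sequences of elements of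
-- γ (Cantor normal form representation), ordered lexicographically with
-- a proper prefix being smaller; equality is pointwise.

OmegaPow : Ordinal → Str
OmegaPow γ = record
  { Carrier = Σ (List C) (Linked (λ x y → (y <γ x) ⊎ (y ≈γ x)))
  ; _≈_     = λ p q → Pointwise _≈γ_ (proj₁ p) (proj₁ q)
  ; _<_     = λ p q → Lex-< _≈γ_ _<γ_ (proj₁ p) (proj₁ q)
  }
  where
    C = Carrier (str γ)
    _≈γ_ = Str._≈_ (str γ)
    _<γ_ = Str._<_ (str γ)

module _ (L : Str) where
  private
    C = Carrier L
    _≈L_ = _≈_ L
    _<L_ = _<_ L

  Between : C → C → C → Set
  Between x y z = ((x <L z) × (z <L y)) ⊎ ((y <L z) × (z <L x))

  _∼F_ : C → C → Set
  x ∼F y = Σ (List C) (λ zs → ∀ z → Between x y z → Any (z ≈L_) zs)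

  -- L/∼F as a structure on the same carrier with equality ∼F
  -- (the quotient presented as a setoid); [x] < [y] iff x < y and
  -- x, y lie in different classes.
  Cond : Str
  Cond = record
    { Carrier = C
    ; _≈_     = _∼F_
    ; _<_     = λ x y → (x <L y) × ¬ (x ∼F y)
    }

-- Two points in different summands are never ∼F-equivalent: if the
-- earlier summand is n ω^γ with γ nonempty (γ = αᵢ has αⱼ below it), then
-- above any point of it there are infinitely many points, obtained by
-- padding its Cantor-normal-form sequence with copies of its last entry.
-- Hence the ∼F-classes of the sum are exactly the ∼F-classes of the
-- individual summands, and the identity map is the isomorphism.
module Submission where

open import Defs
open import Data.Nat using (ℕ; zero; suc; _+_)
open import Data.Fin using (Fin; toℕ) renaming (_<_ to _<ᶠ_)
open import Relation.Binary.PropositionalEquality using (_≡_; _≢_)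

open import Data.Empty using (⊥-elim)
open import Data.Maybe using (Maybe; just; nothing)
import Data.Maybe.Relation.Unary.Any as Maybe
open import Data.Product using (Σ; _×_; _,_; proj₁)
import Data.Product as Product
open import Data.Sum using (inj₁; inj₂)
import Data.Sum as Sum
open import Data.List using (List; []; _∷_; map; mapMaybe; length; replicate; lookup)
open import Data.List.Properties using (length-replicate)
open import Data.List.Relation.Unary.Any using (Any; index)
import Data.List.Relation.Unary.Any as Any
open import Data.List.Relation.Unary.Any.Properties using (map⁺; mapMaybe⁺; lookup-index)
open import Data.List.Relation.Unary.Linked using (Linked; []; [-]; _∷_)
open import Data.List.Relation.Binary.Pointwise using (Pointwise-length)
import Data.List.Relation.Binary.Pointwise as Pointwise
open import Data.List.Relation.Binary.Lex.Strict using (Lex-<; <-asymmetric; halt; next)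
import Data.Nat.Properties as ℕ
import Data.Fin.Properties as Fin
open import Function using (id; _∘_)
open import Relation.Binary using (IsEquivalence; IsStrictTotalOrder; tri<; tri≈; tri>)
open import Relation.Binary.Definitions using (Asymmetric; Reflexive; Symmetric)
import Relation.Binary.Construct.On as On
import Relation.Binary.PropositionalEquality as ≡
open import Relation.Binary.PropositionalEquality using (refl)
open import Relation.Nullary using (¬_; yes; no)

InfinitelyManyAbove : (L : Str) → Carrier L → Set
InfinitelyManyAbove L x =
  Σ (ℕ → Carrier L) λ f → (∀ m → _<_ L x (f m)) × (∀ {m m′} → _≈_ L (f m) (f m′) → m ≡ m′)

module _ (L : Str) where
  open Str L using () renaming (_≈_ to _≈ᴸ_; _<_ to _<ᴸ_)

  ∼F-refl : Asymmetric _<ᴸ_ → Reflexive (_∼F_ L)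
  ∼F-refl asym = [] , λ { _ (inj₁ (p , q)) → ⊥-elim (asym p q)
                        ; _ (inj₂ (p , q)) → ⊥-elim (asym p q) }

  ∼F-sym : Symmetric (_∼F_ L)
  ∼F-sym (zs , covered) = zs , λ z → covered z ∘ Sum.swap

  -- Pigeonhole: the finite list covering the interval would have to
  -- contain one entry equivalent to two distinct points of the family.
  ≁F-if-infinitelyManyBetween : IsEquivalence _≈ᴸ_ → ∀ {x y} (f : ℕ → Carrier L)
    → (∀ m → Between L x y (f m)) → (∀ {m m′} → f m ≈ᴸ f m′ → m ≡ m′)
    → ¬ _∼F_ L x y
  ≁F-if-infinitelyManyBetween isEq f between f-injective (zs , covered) =
    let (t , u , t<u , same-position) = Fin.pigeonhole (ℕ.n<1+n (length zs)) position
    in Fin.<-irrefl (Fin.toℕ-injective (f-injective (f-collide same-position))) t<u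
    where
      open IsEquivalence isEq
      position : Fin (suc (length zs)) → Fin (length zs)
      position t = index (covered (f (toℕ t)) (between (toℕ t)))
      f≈lookup : ∀ t → f (toℕ t) ≈ᴸ lookup zs (position t)
      f≈lookup t = lookup-index (covered (f (toℕ t)) (between (toℕ t)))
      f-collide : ∀ {t u} → position t ≡ position u → f (toℕ t) ≈ᴸ f (toℕ u)
      f-collide {t} {u} eq =
        trans (f≈lookup t) (trans (reflexive (≡.cong (lookup zs) eq)) (sym (f≈lookup u)))

module OrderedSum {k : ℕ} (G : Fin k → Str) where
  private
    S = OSum k G

  osum-isEquivalence : (∀ i → IsEquivalence (_≈_ (G i))) → IsEquivalence (SumEq G)
  osum-isEquivalence isEq = record
    { refl  = λ { {i , _} → same (IsEquivalence.refl (isEq i)) }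
    ; sym   = λ { {i , _} (same p) → same (IsEquivalence.sym (isEq i) p) }
    ; trans = λ { {i , _} (same p) (same q) → same (IsEquivalence.trans (isEq i) p q) }
    }

  osum-asym : (∀ i → Asymmetric (_<_ (G i))) → Asymmetric (SumLt G)
  osum-asym asym (idx p)       (idx q)   = Fin.<-asym p q
  osum-asym asym (idx p)       (inner _) = Fin.<-irrefl refl p
  osum-asym asym (inner _)     (idx q)   = Fin.<-irrefl refl q
  osum-asym asym (inner {i} p) (inner q) = asym i p q

  osum-infinitelyManyAbove : ∀ {i a} → InfinitelyManyAbove (G i) a → InfinitelyManyAbove S (i , a)
  osum-infinitelyManyAbove {i} (f , above , f-injective) =
    (λ m → i , f m) , (λ m → inner (above m)) , λ { (same p) → f-injective p }

  squeezed : ∀ {i a b z} → SumLt G (i , a) z → SumLt G z (i , b)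
    → Σ (Carrier (G i)) λ w → z ≡ (i , w) × _<_ (G i) a w × _<_ (G i) w b
  squeezed (inner p) (inner q) = _ , refl , p , q
  squeezed (idx p)   (idx q)   = ⊥-elim (Fin.<-asym p q)
  squeezed (idx p)   (inner _) = ⊥-elim (Fin.<-irrefl refl p)
  squeezed (inner _) (idx q)   = ⊥-elim (Fin.<-irrefl refl q)

  ∼F-inject : ∀ {i a b} → _∼F_ (G i) a b → _∼F_ S (i , a) (i , b)
  ∼F-inject {i} {a} {b} (ws , covered) = map (i ,_) ws , coveredˢ
    where
      lift : ∀ {w} → Between (G i) a b w → Any (SumEq G (i , w)) (map (i ,_) ws)
      lift between = map⁺ (Any.map same (covered _ between))
      coveredˢ : ∀ z → Between S (i , a) (i , b) z → Any (SumEq G z) (map (i ,_) ws)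
      coveredˢ _ (inj₁ (p , q)) with squeezed p q
      ... | _ , refl , p′ , q′ = lift (inj₁ (p′ , q′))
      coveredˢ _ (inj₂ (p , q)) with squeezed p q
      ... | _ , refl , p′ , q′ = lift (inj₂ (p′ , q′))

  component : (i : Fin k) → Carrier S → Maybe (Carrier (G i))
  component i (j , v) with j Fin.≟ i
  ... | yes refl = just v
  ... | no _     = nothing

  component-self : ∀ i v → component i (i , v) ≡ just v
  component-self i v rewrite ≡.≡-≟-identity Fin._≟_ {i} refl = refl

  ∼F-restrict : ∀ {i a b} → _∼F_ S (i , a) (i , b) → _∼F_ (G i) a b
  ∼F-restrict {i} (zs , covered) =
    mapMaybe (component i) zs ,
    λ w between → mapMaybe⁺ (component i) zs (map⁺ (Any.map match (covered (i , w) (lift between))))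
    where
      lift : ∀ {a b w} → Between (G i) a b w → Between S (i , a) (i , b) (i , w)
      lift = Sum.map (Product.map inner inner) (Product.map inner inner)
      match : ∀ {w z} → SumEq G (i , w) z → Maybe.Any (_≈_ (G i) w) (component i z)
      match (same {y = v} p) rewrite component-self i v = Maybe.just p

  ≁F-across : (∀ i → IsEquivalence (_≈_ (G i))) → ∀ {i j a b} → i <ᶠ j
    → InfinitelyManyAbove (G i) a → ¬ _∼F_ S (i , a) (j , b)
  ≁F-across isEq i<j aboveᵃ =
    let (f , above , f-injective) = osum-infinitelyManyAbove aboveᵃ
    in ≁F-if-infinitelyManyBetween S (osum-isEquivalence isEq) f
         (λ m → inj₁ (above m , idx i<j)) f-injective

  cond-osum≅osum-cond : (∀ i → IsEquivalence (_≈_ (G i))) → (∀ i → Asymmetric (_<_ (G i)))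
    → (∀ i j → i <ᶠ j → ∀ a → InfinitelyManyAbove (G i) a)
    → Cond S ≅ OSum k (λ i → Cond (G i))
  cond-osum≅osum-cond isEq asym unbounded = record
    { to        = id
    ; from      = id
    ; to-cong   = ∼F⇒sumEq
    ; from-cong = λ { (same p) → ∼F-inject p }
    ; to-from   = λ { (i , _) → same (∼F-refl (G i) (asym i)) }
    ; from-to   = λ { (i , _) → ∼F-inject (∼F-refl (G i) (asym i)) }
    ; to-mono   = λ { (idx p , _) → idx p ; (inner p , x≁y) → inner (p , x≁y ∘ ∼F-inject) }
    ; to-refl   = λ { (idx p) → idx p , across p ; (inner (p , a≁b)) → inner p , a≁b ∘ ∼F-restrict }
    }
    where
      across : ∀ {i j a b} → i <ᶠ j → ¬ _∼F_ S (i , a) (j , b)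
      across {i} {j} {a} i<j = ≁F-across isEq i<j (unbounded i j i<j a)
      ∼F⇒sumEq : ∀ {x y} → _∼F_ S x y → SumEq (λ i → Cond (G i)) x y
      ∼F⇒sumEq {i , _} {j , _} x∼y with Fin.<-cmp i j
      ... | tri< i<j _ _    = ⊥-elim (across i<j x∼y)
      ... | tri> _ _ j<i    = ⊥-elim (across j<i (∼F-sym S x∼y))
      ... | tri≈ _ refl _   = same (∼F-restrict x∼y)

module OmegaPower (γ : Ordinal) where
  open IsStrictTotalOrder (isSTO γ) using (asym; <-resp-≈; module Eq)
  private
    C = Carrier (str γ)
    _≈ᵞ_ = _≈_ (str γ)
    _<ᵞ_ = _<_ (str γ)
    NonIncreasing : C → C → Set
    NonIncreasing x y = (y <ᵞ x) Sum.⊎ (y ≈ᵞ x)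

  omegaPow-isEquivalence : IsEquivalence (_≈_ (OmegaPow γ))
  omegaPow-isEquivalence = On.isEquivalence proj₁ (Pointwise.isEquivalence Eq.isEquivalence)

  omegaPow-asym : Asymmetric (_<_ (OmegaPow γ))
  omegaPow-asym = <-asymmetric Eq.sym <-resp-≈ asym

  pad : C → List C → ℕ → List C
  pad e []      m = replicate m e
  pad e (x ∷ l) m = x ∷ pad x l m

  pad-cons-linked : ∀ {x} l m → Linked NonIncreasing (x ∷ l) → Linked NonIncreasing (x ∷ pad x l m)
  pad-cons-linked []      zero    _        = [-]
  pad-cons-linked []      (suc m) _        = inj₂ Eq.refl ∷ pad-cons-linked [] m [-]
  pad-cons-linked (y ∷ l) m       (r ∷ lk) = r ∷ pad-cons-linked l m lk

  pad-linked : ∀ e l m → Linked NonIncreasing l → Linked NonIncreasing (pad e l m)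
  pad-linked e []      zero    _  = []
  pad-linked e []      (suc m) _  = pad-cons-linked [] m [-]
  pad-linked e (x ∷ l) m       lk = pad-cons-linked l m lk

  <-pad : ∀ e l m → Lex-< _≈ᵞ_ _<ᵞ_ l (pad e l (suc m))
  <-pad e []      m = halt
  <-pad e (x ∷ l) m = next Eq.refl (<-pad x l m)

  length-pad : ∀ e l m → length (pad e l m) ≡ length l + m
  length-pad e []      m = length-replicate m
  length-pad e (x ∷ l) m = ≡.cong suc (length-pad x l m)

  omegaPow-infinitelyManyAbove : C → ∀ x → InfinitelyManyAbove (OmegaPow γ) x
  omegaPow-infinitelyManyAbove e (l , lk) =
    (λ m → pad e l (suc m) , pad-linked e l (suc m) lk) , <-pad e l , pad-injective
    where
      pad-injective : ∀ {m m′} → Pointwise.Pointwise _≈ᵞ_ (pad e l (suc m)) (pad e l (suc m′)) → m ≡ m′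
      pad-injective {m} {m′} eq = ℕ.suc-injective (ℕ.+-cancelˡ-≡ (length l) _ _
        (≡.trans (≡.sym (length-pad e l (suc m))) (≡.trans (Pointwise-length eq) (length-pad e l (suc m′)))))

mainTheorem19 : (k : ℕ) (α : Fin k → Ordinal) (n : Fin k → ℕ)
    → (∀ (i j : Fin k) → i <ᶠ j → α j <ₒ α i)
    → (∀ (i : Fin k) → toℕ i ≡ 0 → n i ≢ 0)
    → Cond (OSum k (λ i → Times (n i) (OmegaPow (α i))))
    ≅ OSum k (λ i → Cond (Times (n i) (OmegaPow (α i))))
-- n₁ ≠ 0 only normalises the Cantor normal form; the isomorphism does not need it.
mainTheorem19 k α n decreasing _ =
  cond-osum≅osum-cond (λ i → Times (n i) (OmegaPow (α i)))
                      (λ i → osum-isEquivalence (copies i) (λ _ → omegaPow-isEquivalence (α i)))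
                      (λ i → osum-asym (copies i) (λ _ {x} {y} → omegaPow-asym (α i) {x} {y}))
                      unbounded
  where
    open OrderedSum
    open OmegaPower
    copies : (i : Fin k) → Fin (n i) → Str
    copies i _ = OmegaPow (α i)
    unbounded : ∀ i j → i <ᶠ j → ∀ x → InfinitelyManyAbove (Times (n i) (OmegaPow (α i))) x
    unbounded i j i<j (_ , x) = osum-infinitelyManyAbove (copies i)
      (omegaPow-infinitelyManyAbove (α i) (proj₁ (decreasing i j i<j)) x)
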